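{- Let $p$ be a prime. Two binary quadratic forms with coefficients in $\mathbb{Z}$ and discriminant $1-4p$ are $\mathrm{SL}_2(\mathbb{Z}[\frac1p])$-equivalent if and only if they are $\mathrm{SL}_2(\mathbb{Z})$-equivalent.
   Context: A binary quadratic form $ax^2+bxy+cy^2$ has discriminant $b^2-4ac$; $\mathrm{SL}_2(B)$ acts by linear change of variables. -}

module Defs where

open import Data.Nat using (ℕ; _^_)
open import Data.Nat.Primality using (Prime)
open import Data.Integer as ℤ using (ℤ; +_)
open import Data.Rational as ℚ using (ℚ; _/_)
open import Data.Product using (Σ; ∃; _×_; _,_)
open import Relation.Binary.PropositionalEquality using (_≡_)

record BQF (R : Set) : Set where
  constructor form
  field
    a b c : R

open BQF public

disc : BQF ℤ → ℤ
disc f = b f ℤ.* b f ℤ.- (+ 4) ℤ.* (a f ℤ.* c f)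

-- 2×2 matrices [[α, β], [γ, δ]].
record Mat (R : Set) : Set where
  constructor mat
  field
    α β γ δ : R

open Mat public

detℤ : Mat ℤ → ℤ
detℤ m = α m ℤ.* δ m ℤ.- β m ℤ.* γ m

record SL2ℤ : Set where
  field
    mtx : Mat ℤ
    det≡1 : detℤ mtx ≡ + 1

open SL2ℤ public

-- (f · g)(x , y) = f (α x + β y , γ x + δ y)
actℤ : Mat ℤ → BQF ℤ → BQF ℤ
actℤ m f = form
  (a f ℤ.* (α m ℤ.* α m) ℤ.+ b f ℤ.* (α m ℤ.* γ m) ℤ.+ c f ℤ.* (γ m ℤ.* γ m))
  ((+ 2) ℤ.* a f ℤ.* (α m ℤ.* β m) ℤ.+ b f ℤ.* (α m ℤ.* δ m ℤ.+ β m ℤ.* γ m)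
     ℤ.+ (+ 2) ℤ.* c f ℤ.* (γ m ℤ.* δ m))
  (a f ℤ.* (β m ℤ.* β m) ℤ.+ b f ℤ.* (β m ℤ.* δ m) ℤ.+ c f ℤ.* (δ m ℤ.* δ m))

SL2ℤ-equiv : BQF ℤ → BQF ℤ → Set
SL2ℤ-equiv f g = Σ SL2ℤ λ M → actℤ (mtx M) f ≡ g

ι : ℤ → ℚ
ι z = z / 1

ιF : BQF ℤ → BQF ℚ
ιF f = form (ι (a f)) (ι (b f)) (ι (c f))

-- q ∈ ℤ[1/p]  :⇔  q = n / p^k for some n ∈ ℤ, k ∈ ℕ
-- (stated as q · p^k ∈ ℤ to avoid a NonZero instance for p^k)
InZ[1/p] : ℕ → ℚ → Set
InZ[1/p] p q = ∃ λ (k : ℕ) → ∃ λ (n : ℤ) → q ℚ.* ι (+ (p ^ k)) ≡ ι n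

detℚ : Mat ℚ → ℚ
detℚ m = α m ℚ.* δ m ℚ.- β m ℚ.* γ m

record SL2Z[1/p] (p : ℕ) : Set where
  field
    mtxp : Mat ℚ
    αInt : InZ[1/p] p (α mtxp)
    βInt : InZ[1/p] p (β mtxp)
    γInt : InZ[1/p] p (γ mtxp)
    δInt : InZ[1/p] p (δ mtxp)
    detp≡1 : detℚ mtxp ≡ ℚ.1ℚ

open SL2Z[1/p] public

actℚ : Mat ℚ → BQF ℚ → BQF ℚ
actℚ m f = form
  (a f ℚ.* (α m ℚ.* α m) ℚ.+ b f ℚ.* (α m ℚ.* γ m) ℚ.+ c f ℚ.* (γ m ℚ.* γ m))
  (ι (+ 2) ℚ.* a f ℚ.* (α m ℚ.* β m) ℚ.+ b f ℚ.* (α m ℚ.* δ m ℚ.+ β m ℚ.* γ m)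
     ℚ.+ ι (+ 2) ℚ.* c f ℚ.* (γ m ℚ.* δ m))
  (a f ℚ.* (β m ℚ.* β m) ℚ.+ b f ℚ.* (β m ℚ.* δ m) ℚ.+ c f ℚ.* (δ m ℚ.* δ m))

SL2Z[1/p]-equiv : ℕ → BQF ℤ → BQF ℤ → Set
SL2Z[1/p]-equiv p f g = Σ (SL2Z[1/p] p) λ M → actℚ (mtxp M) (ιF f) ≡ ιF g

-- Let M ∈ SL₂(ℤ[1/p]) carry f to g. Clearing denominators gives an integer
-- matrix N with det N = p^e and N·f = p^e g; it remains to divide p out of N
-- one factor at a time. As disc f = 1 − 4p, f = [A, 1 + 2h, C] with
-- AC − h² − h = p, and W = [[−h, −C], [A, h + 1]] has trace 1 and determinant
-- p: it is multiplication by the element (1 + √(1 − 4p))/2 of norm p. Both W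
-- and its adjugate 1 − W (multiplication by the conjugate) carry f to p f.
-- Modulo p, every entry of W v times every entry of adj(W) v is a multiple of
-- f(v), so a zero of f mod p is killed mod p by adj W or by W, i.e. lies in the
-- image of W or of adj W. The two columns of N and their sum are zeros of f
-- mod p, hence both columns lie in the same image, N = W N' or N = adj(W) N',
-- and N' carries f to p^(e−1) g.

module Submission where

open import Defs
open import Data.Nat as ℕ using (ℕ; zero; suc; _^_; _≤_; _∸_)
import Data.Nat.Properties as ℕ
import Data.Nat.Divisibility as ℕ
open import Data.Nat.Primality using (Prime; prime⇒nonZero; euclidsLemma)
open import Data.Integer using (ℤ; +_; _+_; _-_; _*_; -_; ∣_∣; _%ℕ_; _/ℕ_; NonZero)
import Data.Integer.Properties as ℤ
open import Data.Integer.DivMod using (a≡a%ℕn+[a/ℕn]*n; n%ℕd<d)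
open import Data.Integer.Divisibility.Signed
  using (_∣_; _∣?_; divides; ∣ᵤ⇒∣; ∣⇒∣ᵤ; ∣-refl; ∣m∣n⇒∣m+n; ∣m+n∣m⇒∣n; ∣m+n∣n⇒∣m;
         ∣m⇒∣m*n; ∣n⇒∣m*n)
open import Data.Integer.Tactic.RingSolver using (solve-∀)
open import Data.Rational as ℚ using (ℚ; toℚᵘ)
open import Data.Rational.Properties
  using (+-*-commutativeRing; toℚᵘ-injective; toℚᵘ-fromℚᵘ; toℚᵘ-homo-+; toℚᵘ-homo-*; toℚᵘ-homo‿-)
  renaming (*-assoc to ℚ-*-assoc; *-identityʳ to ℚ-*-identityʳ)
open import Data.Rational.Unnormalised using (mkℚᵘ; *≡*) renaming (_≃_ to _≃ᵘ_)
import Data.Rational.Unnormalised.Properties as ℚᵘ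
open import Data.Empty using (⊥-elim)
open import Data.Maybe using (nothing)
open import Data.Product using (Σ; ∃; _×_; _,_; proj₁; proj₂)
open import Data.Sum as Sum using (_⊎_; inj₁; inj₂)
open import Function.Bundles using (_⇔_; mk⇔)
open import Level using (0ℓ)
open import Relation.Nullary using (yes; no; ¬_; contradiction)
open import Relation.Binary.PropositionalEquality
open ≡-Reasoning
import Tactic.RingSolver as RingSolver
import Tactic.RingSolver.Core.AlmostCommutativeRing as ACR

ℚ-ring : ACR.AlmostCommutativeRing 0ℓ 0ℓ
ℚ-ring = ACR.fromCommutativeRing +-*-commutativeRing (λ _ → nothing)

form-cong : ∀ {R : Set} {x y z x′ y′ z′ : R} →
  x ≡ x′ → y ≡ y′ → z ≡ z′ → form x y z ≡ form x′ y′ z′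
form-cong refl refl refl = refl

mat-cong : ∀ {R : Set} {w x y z w′ x′ y′ z′ : R} →
  w ≡ w′ → x ≡ x′ → y ≡ y′ → z ≡ z′ → mat w x y z ≡ mat w′ x′ y′ z′
mat-cong refl refl refl refl = refl

ℤ² : Set
ℤ² = ℤ × ℤ

infixl 6 _+ᵥ_
infixr 7 _•_ _·_
infixl 7 _*ₘ_
infix 4 _∣ᵥ_

_+ᵥ_ : ℤ² → ℤ² → ℤ²
(x₁ , y₁) +ᵥ (x₂ , y₂) = x₁ + x₂ , y₁ + y₂

_•_ : ℤ → ℤ² → ℤ²
k • (x , y) = k * x , k * y

_·_ : Mat ℤ → ℤ² → ℤ²
M · (x , y) = α M * x + β M * y , γ M * x + δ M * y

col₁ col₂ : Mat ℤ → ℤ²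
col₁ M = α M , γ M
col₂ M = β M , δ M

fromCols : ℤ² → ℤ² → Mat ℤ
fromCols (x₁ , y₁) (x₂ , y₂) = mat x₁ x₂ y₁ y₂

_*ₘ_ : Mat ℤ → Mat ℤ → Mat ℤ
M *ₘ N = fromCols (M · col₁ N) (M · col₂ N)

adj : Mat ℤ → Mat ℤ
adj M = mat (δ M) (- β M) (- γ M) (α M)

value : BQF ℤ → ℤ² → ℤ
value q (x , y) = a q * (x * x) + b q * (x * y) + c q * (y * y)

polar : BQF ℤ → ℤ² → ℤ² → ℤ
polar q (x₁ , y₁) (x₂ , y₂) =
  + 2 * a q * (x₁ * x₂) + b q * (x₁ * y₂ + x₂ * y₁) + + 2 * c q * (y₁ * y₂)

-- actℤ M q is, definitionally,
-- form (value q (col₁ M)) (polar q (col₁ M) (col₂ M)) (value q (col₂ M)).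

scale : ℤ → BQF ℤ → BQF ℤ
scale k q = form (k * a q) (k * b q) (k * c q)

·-+ᵥ : ∀ M v w → M · (v +ᵥ w) ≡ M · v +ᵥ M · w
·-+ᵥ (mat a₀ b₀ c₀ d₀) (x₁ , y₁) (x₂ , y₂) =
  cong₂ _,_ (linear a₀ b₀ x₁ y₁ x₂ y₂) (linear c₀ d₀ x₁ y₁ x₂ y₂)
  where
  linear : ∀ a b x₁ y₁ x₂ y₂ →
    a * (x₁ + x₂) + b * (y₁ + y₂) ≡ (a * x₁ + b * y₁) + (a * x₂ + b * y₂)
  linear = solve-∀

·-• : ∀ M k v → M · (k • v) ≡ k • (M · v)
·-• (mat a₀ b₀ c₀ d₀) k (x , y) = cong₂ _,_ (homogeneous a₀ b₀ k x y) (homogeneous c₀ d₀ k x y)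
  where
  homogeneous : ∀ a b k x y → a * (k * x) + b * (k * y) ≡ k * (a * x + b * y)
  homogeneous = solve-∀

•-injective : ∀ {k v w} .{{_ : NonZero k}} → k • v ≡ k • w → v ≡ w
•-injective {k} eq =
  cong₂ _,_ (ℤ.*-cancelˡ-≡ k _ _ (cong proj₁ eq)) (ℤ.*-cancelˡ-≡ k _ _ (cong proj₂ eq))

·-adj : ∀ M v → M · (adj M · v) ≡ detℤ M • v
·-adj (mat a₀ b₀ c₀ d₀) (x , y) = cong₂ _,_ (first a₀ b₀ c₀ d₀ x y) (second a₀ b₀ c₀ d₀ x y)
  where
  first : ∀ a b c d x y → a * (d * x + - b * y) + b * (- c * x + a * y) ≡ (a * d - b * c) * x
  first = solve-∀
  second : ∀ a b c d x y → c * (d * x + - b * y) + d * (- c * x + a * y) ≡ (a * d - b * c) * y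
  second = solve-∀

adj-· : ∀ M v → adj M · (M · v) ≡ detℤ M • v
adj-· (mat a₀ b₀ c₀ d₀) (x , y) = cong₂ _,_ (first a₀ b₀ c₀ d₀ x y) (second a₀ b₀ c₀ d₀ x y)
  where
  first : ∀ a b c d x y → d * (a * x + b * y) + - b * (c * x + d * y) ≡ (a * d - b * c) * x
  first = solve-∀
  second : ∀ a b c d x y → - c * (a * x + b * y) + a * (c * x + d * y) ≡ (a * d - b * c) * y
  second = solve-∀

detℤ-adj : ∀ M → detℤ (adj M) ≡ detℤ M
detℤ-adj (mat a₀ b₀ c₀ d₀) = identity a₀ b₀ c₀ d₀
  where
  identity : ∀ a b c d → d * a - - b * - c ≡ a * d - b * c
  identity = solve-∀

detℤ-*ₘ : ∀ M N → detℤ (M *ₘ N) ≡ detℤ M * detℤ N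
detℤ-*ₘ (mat a₀ b₀ c₀ d₀) (mat a₁ b₁ c₁ d₁) = identity a₀ b₀ c₀ d₀ a₁ b₁ c₁ d₁
  where
  identity : ∀ a b c d a′ b′ c′ d′ →
    (a * a′ + b * c′) * (c * b′ + d * d′) - (a * b′ + b * d′) * (c * a′ + d * c′)
      ≡ (a * d - b * c) * (a′ * d′ - b′ * c′)
  identity = solve-∀

value-+ᵥ : ∀ q v w → value q (v +ᵥ w) ≡ value q v + polar q v w + value q w
value-+ᵥ (form a₀ b₀ c₀) (x₁ , y₁) (x₂ , y₂) = identity a₀ b₀ c₀ x₁ y₁ x₂ y₂
  where
  identity : ∀ a b c x₁ y₁ x₂ y₂ →
    a * ((x₁ + x₂) * (x₁ + x₂)) + b * ((x₁ + x₂) * (y₁ + y₂)) + c * ((y₁ + y₂) * (y₁ + y₂))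
      ≡ (a * (x₁ * x₁) + b * (x₁ * y₁) + c * (y₁ * y₁))
        + (+ 2 * a * (x₁ * x₂) + b * (x₁ * y₂ + x₂ * y₁) + + 2 * c * (y₁ * y₂))
        + (a * (x₂ * x₂) + b * (x₂ * y₂) + c * (y₂ * y₂))
  identity = solve-∀

value-act : ∀ M q v → value (actℤ M q) v ≡ value q (M · v)
value-act (mat a₀ b₀ c₀ d₀) (form a b c) (x , y) = identity a b c a₀ b₀ c₀ d₀ x y
  where
  identity : ∀ a b c a₀ b₀ c₀ d₀ x y →
    (a * (a₀ * a₀) + b * (a₀ * c₀) + c * (c₀ * c₀)) * (x * x)
      + (+ 2 * a * (a₀ * b₀) + b * (a₀ * d₀ + b₀ * c₀) + + 2 * c * (c₀ * d₀)) * (x * y)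
      + (a * (b₀ * b₀) + b * (b₀ * d₀) + c * (d₀ * d₀)) * (y * y)
    ≡ a * ((a₀ * x + b₀ * y) * (a₀ * x + b₀ * y))
      + b * ((a₀ * x + b₀ * y) * (c₀ * x + d₀ * y))
      + c * ((c₀ * x + d₀ * y) * (c₀ * x + d₀ * y))
  identity = solve-∀

polar-act : ∀ M q v w → polar (actℤ M q) v w ≡ polar q (M · v) (M · w)
polar-act (mat a₀ b₀ c₀ d₀) (form a b c) (x₁ , y₁) (x₂ , y₂) =
  identity a b c a₀ b₀ c₀ d₀ x₁ y₁ x₂ y₂
  where
  identity : ∀ a b c a₀ b₀ c₀ d₀ x₁ y₁ x₂ y₂ →
    + 2 * (a * (a₀ * a₀) + b * (a₀ * c₀) + c * (c₀ * c₀)) * (x₁ * x₂)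
      + (+ 2 * a * (a₀ * b₀) + b * (a₀ * d₀ + b₀ * c₀) + + 2 * c * (c₀ * d₀)) * (x₁ * y₂ + x₂ * y₁)
      + + 2 * (a * (b₀ * b₀) + b * (b₀ * d₀) + c * (d₀ * d₀)) * (y₁ * y₂)
    ≡ + 2 * a * ((a₀ * x₁ + b₀ * y₁) * (a₀ * x₂ + b₀ * y₂))
      + b * ((a₀ * x₁ + b₀ * y₁) * (c₀ * x₂ + d₀ * y₂) + (a₀ * x₂ + b₀ * y₂) * (c₀ * x₁ + d₀ * y₁))
      + + 2 * c * ((c₀ * x₁ + d₀ * y₁) * (c₀ * x₂ + d₀ * y₂))
  identity = solve-∀

value-scale : ∀ k q v → value (scale k q) v ≡ k * value q v
value-scale k (form a b c) (x , y) = identity k a b c x y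
  where
  identity : ∀ k a b c x y →
    k * a * (x * x) + k * b * (x * y) + k * c * (y * y) ≡ k * (a * (x * x) + b * (x * y) + c * (y * y))
  identity = solve-∀

polar-scale : ∀ k q v w → polar (scale k q) v w ≡ k * polar q v w
polar-scale k (form a b c) (x₁ , y₁) (x₂ , y₂) = identity k a b c x₁ y₁ x₂ y₂
  where
  identity : ∀ k a b c x₁ y₁ x₂ y₂ →
    + 2 * (k * a) * (x₁ * x₂) + k * b * (x₁ * y₂ + x₂ * y₁) + + 2 * (k * c) * (y₁ * y₂)
      ≡ k * (+ 2 * a * (x₁ * x₂) + b * (x₁ * y₂ + x₂ * y₁) + + 2 * c * (y₁ * y₂))
  identity = solve-∀

actℤ-*ₘ : ∀ M N q → actℤ (M *ₘ N) q ≡ actℤ N (actℤ M q)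
actℤ-*ₘ M N q = form-cong
  (sym (value-act M q (col₁ N)))
  (sym (polar-act M q (col₁ N) (col₂ N)))
  (sym (value-act M q (col₂ N)))

actℤ-scale : ∀ M k q → actℤ M (scale k q) ≡ scale k (actℤ M q)
actℤ-scale M k q = form-cong
  (value-scale k q (col₁ M)) (polar-scale k q (col₁ M) (col₂ M)) (value-scale k q (col₂ M))

scale-1 : ∀ q → scale (+ 1) q ≡ q
scale-1 q = form-cong (ℤ.*-identityˡ (a q)) (ℤ.*-identityˡ (b q)) (ℤ.*-identityˡ (c q))

scale-* : ∀ k l q → scale (k * l) q ≡ scale k (scale l q)
scale-* k l q = form-cong (ℤ.*-assoc k l (a q)) (ℤ.*-assoc k l (b q)) (ℤ.*-assoc k l (c q))

scale-injective : ∀ {k q r} .{{_ : NonZero k}} → scale k q ≡ scale k r → q ≡ r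
scale-injective {k} eq = form-cong
  (ℤ.*-cancelˡ-≡ k _ _ (cong a eq)) (ℤ.*-cancelˡ-≡ k _ _ (cong b eq)) (ℤ.*-cancelˡ-≡ k _ _ (cong c eq))

cancel-factor : ∀ {k d X N′ N q g} .{{_ : NonZero k}} →
  detℤ X ≡ k → actℤ X q ≡ scale k q → X *ₘ N′ ≡ N →
  detℤ N ≡ k * d → actℤ N q ≡ scale (k * d) g →
  detℤ N′ ≡ d × actℤ N′ q ≡ scale d g
cancel-factor {k} {d} {X} {N′} {N} {q} {g} det-X act-X XN′≡N det-N act-N =
  ℤ.*-cancelˡ-≡ k _ _ det-eq , scale-injective {k} act-eq
  where
  det-eq : k * detℤ N′ ≡ k * d
  det-eq = begin
    k * detℤ N′          ≡⟨ cong (_* detℤ N′) det-X ⟨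
    detℤ X * detℤ N′     ≡⟨ detℤ-*ₘ X N′ ⟨
    detℤ (X *ₘ N′)       ≡⟨ cong detℤ XN′≡N ⟩
    detℤ N               ≡⟨ det-N ⟩
    k * d                ∎
  act-eq : scale k (actℤ N′ q) ≡ scale k (scale d g)
  act-eq = begin
    scale k (actℤ N′ q)  ≡⟨ actℤ-scale N′ k q ⟨
    actℤ N′ (scale k q)  ≡⟨ cong (actℤ N′) act-X ⟨
    actℤ N′ (actℤ X q)   ≡⟨ actℤ-*ₘ X N′ q ⟨
    actℤ (X *ₘ N′) q     ≡⟨ cong (λ M → actℤ M q) XN′≡N ⟩
    actℤ N q             ≡⟨ act-N ⟩
    scale (k * d) g      ≡⟨ scale-* k d g ⟩
    scale k (scale d g)  ∎

_∣ᵥ_ : ℤ → ℤ² → Set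
k ∣ᵥ (x , y) = (k ∣ x) × (k ∣ y)

KerMod : ℤ → Mat ℤ → ℤ² → Set
KerMod k Y v = k ∣ᵥ (Y · v)

KerMod-+ᵥ-cancelˡ : ∀ {k Y v w} → KerMod k Y (v +ᵥ w) → KerMod k Y v → KerMod k Y w
KerMod-+ᵥ-cancelˡ {k} {Y} {v} {w} ker ker-v
  with subst (k ∣ᵥ_) (·-+ᵥ Y v w) ker | ker-v
... | k∣₁ , k∣₂ | k∣v₁ , k∣v₂ = ∣m+n∣m⇒∣n k∣₁ k∣v₁ , ∣m+n∣m⇒∣n k∣₂ k∣v₂

KerMod-+ᵥ-cancelʳ : ∀ {k Y v w} → KerMod k Y (v +ᵥ w) → KerMod k Y w → KerMod k Y v
KerMod-+ᵥ-cancelʳ {k} {Y} {v} {w} ker ker-w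
  with subst (k ∣ᵥ_) (·-+ᵥ Y v w) ker | ker-w
... | k∣₁ , k∣₂ | k∣w₁ , k∣w₂ = ∣m+n∣n⇒∣m k∣₁ k∣w₁ , ∣m+n∣n⇒∣m k∣₂ k∣w₂

same-KerMod : ∀ {k Y Z v w} →
  KerMod k Y v ⊎ KerMod k Z v → KerMod k Y w ⊎ KerMod k Z w →
  KerMod k Y (v +ᵥ w) ⊎ KerMod k Z (v +ᵥ w) →
  KerMod k Y v × KerMod k Y w ⊎ KerMod k Z v × KerMod k Z w
same-KerMod                 (inj₁ y) (inj₁ y′) _        = inj₁ (y , y′)
same-KerMod                 (inj₂ z) (inj₂ z′) _        = inj₂ (z , z′)
same-KerMod {Y = Y} {v = v} (inj₁ y) (inj₂ z′) (inj₁ s) =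
  inj₁ (y , KerMod-+ᵥ-cancelˡ {Y = Y} {v} s y)
same-KerMod {Z = Z} {w = w} (inj₁ y) (inj₂ z′) (inj₂ s) =
  inj₂ (KerMod-+ᵥ-cancelʳ {Y = Z} {w = w} s z′ , z′)
same-KerMod {Y = Y} {w = w} (inj₂ z) (inj₁ y′) (inj₁ s) =
  inj₁ (KerMod-+ᵥ-cancelʳ {Y = Y} {w = w} s y′ , y′)
same-KerMod {Z = Z} {v = v} (inj₂ z) (inj₁ y′) (inj₂ s) =
  inj₂ (z , KerMod-+ᵥ-cancelˡ {Y = Z} {v} s z)

KerMod⇒image : ∀ {k X Y v} .{{_ : NonZero k}} →
  (∀ u → X · (Y · u) ≡ k • u) → KerMod k Y v → ∃ λ q → X · q ≡ v
KerMod⇒image {k} {X} {Y} {v} XY≡k (divides q₁ eq₁ , divides q₂ eq₂) =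
  (q₁ , q₂) , •-injective {k} (begin
    k • (X · (q₁ , q₂))   ≡⟨ ·-• X k (q₁ , q₂) ⟨
    X · (k • (q₁ , q₂))   ≡⟨ cong (X ·_) Yv≡kq ⟨
    X · (Y · v)           ≡⟨ XY≡k v ⟩
    k • v                 ∎)
  where
  Yv≡kq : Y · v ≡ k • (q₁ , q₂)
  Yv≡kq = cong₂ _,_ (trans eq₁ (ℤ.*-comm q₁ k)) (trans eq₂ (ℤ.*-comm q₂ k))

euclidsLemmaℤ : ∀ {p} x y → Prime p → + p ∣ x * y → (+ p ∣ x) ⊎ (+ p ∣ y)
euclidsLemmaℤ {p} x y p-prime p∣xy = Sum.map ∣ᵤ⇒∣ ∣ᵤ⇒∣
  (euclidsLemma ∣ x ∣ ∣ y ∣ p-prime (subst (p ℕ.∣_) (ℤ.abs-* x y) (∣⇒∣ᵤ p∣xy)))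

prime∣*∧∤ʳ⇒∣ˡ : ∀ {p w u} → Prime p → + p ∣ w * u → ¬ + p ∣ u → + p ∣ w
prime∣*∧∤ʳ⇒∣ˡ {w = w} {u} p-prime p∣wu p∤u =
  Sum.fromInj₁ (λ p∣u → contradiction p∣u p∤u) (euclidsLemmaℤ w u p-prime p∣wu)

prime-∣ᵥ-⊎ : ∀ {p u₁ u₂ w₁ w₂} → Prime p →
  + p ∣ w₁ * u₁ → + p ∣ w₂ * u₁ → + p ∣ w₁ * u₂ → + p ∣ w₂ * u₂ →
  (+ p ∣ᵥ (u₁ , u₂)) ⊎ (+ p ∣ᵥ (w₁ , w₂))
prime-∣ᵥ-⊎ {p} {u₁} {u₂} p-prime p∣w₁u₁ p∣w₂u₁ p∣w₁u₂ p∣w₂u₂ with + p ∣? u₁ | + p ∣? u₂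
... | yes p∣u₁ | yes p∣u₂ = inj₁ (p∣u₁ , p∣u₂)
... | no p∤u₁  | _        =
  inj₂ (prime∣*∧∤ʳ⇒∣ˡ p-prime p∣w₁u₁ p∤u₁ , prime∣*∧∤ʳ⇒∣ˡ p-prime p∣w₂u₁ p∤u₁)
... | yes _    | no p∤u₂  =
  inj₂ (prime∣*∧∤ʳ⇒∣ˡ p-prime p∣w₁u₂ p∤u₂ , prime∣*∧∤ʳ⇒∣ˡ p-prime p∣w₂u₂ p∤u₂)

ι-toℚᵘ : ∀ z → toℚᵘ (ι z) ≃ᵘ mkℚᵘ z 0
ι-toℚᵘ z = toℚᵘ-fromℚᵘ (mkℚᵘ z 0)

ι-+ : ∀ x y → ι (x + y) ≡ ι x ℚ.+ ι y
ι-+ x y = toℚᵘ-injective (ℚᵘ.≃-trans (ι-toℚᵘ (x + y)) (ℚᵘ.≃-sym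
  (ℚᵘ.≃-trans (toℚᵘ-homo-+ (ι x) (ι y))
    (ℚᵘ.≃-trans (ℚᵘ.+-cong (ι-toℚᵘ x) (ι-toℚᵘ y)) (*≡* (identity x y))))))
  where
  identity : ∀ x y → (x * + 1 + y * + 1) * + 1 ≡ (x + y) * + 1
  identity = solve-∀

ι-* : ∀ x y → ι (x * y) ≡ ι x ℚ.* ι y
ι-* x y = toℚᵘ-injective (ℚᵘ.≃-trans (ι-toℚᵘ (x * y)) (ℚᵘ.≃-sym
  (ℚᵘ.≃-trans (toℚᵘ-homo-* (ι x) (ι y)) (ℚᵘ.*-cong (ι-toℚᵘ x) (ι-toℚᵘ y)))))

ι-neg : ∀ x → ι (- x) ≡ ℚ.- ι x
ι-neg x = toℚᵘ-injective (ℚᵘ.≃-trans (ι-toℚᵘ (- x)) (ℚᵘ.≃-sym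
  (ℚᵘ.≃-trans (toℚᵘ-homo‿- (ι x)) (ℚᵘ.-‿cong (ι-toℚᵘ x)))))

ι-- : ∀ x y → ι (x - y) ≡ ι x ℚ.- ι y
ι-- x y = trans (ι-+ x (- y)) (cong (ι x ℚ.+_) (ι-neg y))

ι-injective : ∀ {x y} → ι x ≡ ι y → x ≡ y
ι-injective {x} {y} eq
  with ℚᵘ.≃-trans (ℚᵘ.≃-sym (ι-toℚᵘ x)) (ℚᵘ.≃-trans (ℚᵘ.≃-reflexive (cong toℚᵘ eq)) (ι-toℚᵘ y))
... | *≡* x*1≡y*1 = ℤ.*-cancelʳ-≡ x y (+ 1) x*1≡y*1

ι-+₃ : ∀ x y z → ι (x + y + z) ≡ ι x ℚ.+ ι y ℚ.+ ι z
ι-+₃ x y z = trans (ι-+ (x + y) z) (cong (ℚ._+ ι z) (ι-+ x y))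

ι-*₃ : ∀ x y z → ι (x * (y * z)) ≡ ι x ℚ.* (ι y ℚ.* ι z)
ι-*₃ x y z = trans (ι-* x (y * z)) (cong (ι x ℚ.*_) (ι-* y z))

ιM : Mat ℤ → Mat ℚ
ιM M = mat (ι (α M)) (ι (β M)) (ι (γ M)) (ι (δ M))

ιF-injective : ∀ {q r} → ιF q ≡ ιF r → q ≡ r
ιF-injective eq =
  form-cong (ι-injective (cong a eq)) (ι-injective (cong b eq)) (ι-injective (cong c eq))

ι-detℤ : ∀ M → ι (detℤ M) ≡ detℚ (ιM M)
ι-detℤ M = trans (ι-- (α M * δ M) (β M * γ M)) (cong₂ ℚ._-_ (ι-* (α M) (δ M)) (ι-* (β M) (γ M)))

ι-value : ∀ q x y → ι (value q (x , y)) ≡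
  ι (a q) ℚ.* (ι x ℚ.* ι x) ℚ.+ ι (b q) ℚ.* (ι x ℚ.* ι y) ℚ.+ ι (c q) ℚ.* (ι y ℚ.* ι y)
ι-value q x y = trans (ι-+₃ (a q * (x * x)) (b q * (x * y)) (c q * (y * y)))
  (cong₂ ℚ._+_ (cong₂ ℚ._+_ (ι-*₃ (a q) x x) (ι-*₃ (b q) x y)) (ι-*₃ (c q) y y))

ι-polar : ∀ q x₁ y₁ x₂ y₂ → ι (polar q (x₁ , y₁) (x₂ , y₂)) ≡
  ι (+ 2) ℚ.* ι (a q) ℚ.* (ι x₁ ℚ.* ι x₂)
  ℚ.+ ι (b q) ℚ.* (ι x₁ ℚ.* ι y₂ ℚ.+ ι x₂ ℚ.* ι y₁)
  ℚ.+ ι (+ 2) ℚ.* ι (c q) ℚ.* (ι y₁ ℚ.* ι y₂)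
ι-polar q x₁ y₁ x₂ y₂ =
  trans (ι-+₃ (+ 2 * a q * (x₁ * x₂)) (b q * (x₁ * y₂ + x₂ * y₁)) (+ 2 * c q * (y₁ * y₂)))
    (cong₂ ℚ._+_ (cong₂ ℚ._+_ (twice (a q) x₁ x₂) middle) (twice (c q) y₁ y₂))
  where
  twice : ∀ k x y → ι (+ 2 * k * (x * y)) ≡ ι (+ 2) ℚ.* ι k ℚ.* (ι x ℚ.* ι y)
  twice k x y = trans (ι-* (+ 2 * k) (x * y)) (cong₂ ℚ._*_ (ι-* (+ 2) k) (ι-* x y))
  middle : ι (b q * (x₁ * y₂ + x₂ * y₁)) ≡ ι (b q) ℚ.* (ι x₁ ℚ.* ι y₂ ℚ.+ ι x₂ ℚ.* ι y₁)
  middle = trans (ι-* (b q) (x₁ * y₂ + x₂ * y₁))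
    (cong (ι (b q) ℚ.*_) (trans (ι-+ (x₁ * y₂) (x₂ * y₁)) (cong₂ ℚ._+_ (ι-* x₁ y₂) (ι-* x₂ y₁))))

ι-actℤ : ∀ M q → ιF (actℤ M q) ≡ actℚ (ιM M) (ιF q)
ι-actℤ M q = form-cong
  (ι-value q (α M) (γ M)) (ι-polar q (α M) (γ M) (β M) (δ M)) (ι-value q (β M) (δ M))

scaleℚ : ℚ → BQF ℚ → BQF ℚ
scaleℚ s F = form (s ℚ.* a F) (s ℚ.* b F) (s ℚ.* c F)

ιF-scale : ∀ k q → ιF (scale k q) ≡ scaleℚ (ι k) (ιF q)
ιF-scale k q = form-cong (ι-* k (a q)) (ι-* k (b q)) (ι-* k (c q))

-- Clearing denominators

_•ₘ_ : ℚ → Mat ℚ → Mat ℚ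
s •ₘ m = mat (α m ℚ.* s) (β m ℚ.* s) (γ m ℚ.* s) (δ m ℚ.* s)

detℚ-•ₘ : ∀ s m → detℚ (s •ₘ m) ≡ (s ℚ.* s) ℚ.* detℚ m
detℚ-•ₘ s (mat a₀ b₀ c₀ d₀) = identity s a₀ b₀ c₀ d₀
  where
  identity : ∀ s a b c d →
    (a ℚ.* s) ℚ.* (d ℚ.* s) ℚ.- (b ℚ.* s) ℚ.* (c ℚ.* s) ≡ (s ℚ.* s) ℚ.* (a ℚ.* d ℚ.- b ℚ.* c)
  identity = RingSolver.solve-∀ ℚ-ring

actℚ-•ₘ : ∀ s m F → actℚ (s •ₘ m) F ≡ scaleℚ (s ℚ.* s) (actℚ m F)
actℚ-•ₘ s (mat a₀ b₀ c₀ d₀) (form a b c) =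
  form-cong (quadratic s a b c a₀ c₀) (bilinear (ι (+ 2)) s a b c a₀ b₀ c₀ d₀) (quadratic s a b c b₀ d₀)
  where
  quadratic : ∀ s a b c x y →
    a ℚ.* ((x ℚ.* s) ℚ.* (x ℚ.* s)) ℚ.+ b ℚ.* ((x ℚ.* s) ℚ.* (y ℚ.* s)) ℚ.+ c ℚ.* ((y ℚ.* s) ℚ.* (y ℚ.* s))
      ≡ (s ℚ.* s) ℚ.* (a ℚ.* (x ℚ.* x) ℚ.+ b ℚ.* (x ℚ.* y) ℚ.+ c ℚ.* (y ℚ.* y))
  quadratic = RingSolver.solve-∀ ℚ-ring
  bilinear : ∀ t s a b c x₁ x₂ y₁ y₂ →
    t ℚ.* a ℚ.* ((x₁ ℚ.* s) ℚ.* (x₂ ℚ.* s))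
      ℚ.+ b ℚ.* ((x₁ ℚ.* s) ℚ.* (y₂ ℚ.* s) ℚ.+ (x₂ ℚ.* s) ℚ.* (y₁ ℚ.* s))
      ℚ.+ t ℚ.* c ℚ.* ((y₁ ℚ.* s) ℚ.* (y₂ ℚ.* s))
    ≡ (s ℚ.* s) ℚ.* (t ℚ.* a ℚ.* (x₁ ℚ.* x₂) ℚ.+ b ℚ.* (x₁ ℚ.* y₂ ℚ.+ x₂ ℚ.* y₁) ℚ.+ t ℚ.* c ℚ.* (y₁ ℚ.* y₂))
  bilinear = RingSolver.solve-∀ ℚ-ring

ι-pow-+ : ∀ p k j → ι (+ (p ^ (k ℕ.+ j))) ≡ ι (+ (p ^ k)) ℚ.* ι (+ (p ^ j))
ι-pow-+ p k j = begin
  ι (+ (p ^ (k ℕ.+ j)))            ≡⟨ cong (λ n → ι (+ n)) (ℕ.^-distribˡ-+-* p k j) ⟩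
  ι (+ (p ^ k ℕ.* p ^ j))          ≡⟨ cong ι (ℤ.pos-* (p ^ k) (p ^ j)) ⟩
  ι (+ (p ^ k) * + (p ^ j))        ≡⟨ ι-* (+ (p ^ k)) (+ (p ^ j)) ⟩
  ι (+ (p ^ k)) ℚ.* ι (+ (p ^ j))  ∎

InZ[1/p]-raise : ∀ p q {K} (i : InZ[1/p] p q) → proj₁ i ≤ K → ∃ λ n → q ℚ.* ι (+ (p ^ K)) ≡ ι n
InZ[1/p]-raise p q {K} (k , n , eq) k≤K = n * + (p ^ j) , (begin
  q ℚ.* ι (+ (p ^ K))                          ≡⟨ cong (λ e → q ℚ.* ι (+ (p ^ e))) (ℕ.m+[n∸m]≡n k≤K) ⟨
  q ℚ.* ι (+ (p ^ (k ℕ.+ j)))                  ≡⟨ cong (q ℚ.*_) (ι-pow-+ p k j) ⟩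
  q ℚ.* (ι (+ (p ^ k)) ℚ.* ι (+ (p ^ j)))      ≡⟨ ℚ-*-assoc q _ _ ⟨
  q ℚ.* ι (+ (p ^ k)) ℚ.* ι (+ (p ^ j))        ≡⟨ cong (ℚ._* ι (+ (p ^ j))) eq ⟩
  ι n ℚ.* ι (+ (p ^ j))                        ≡⟨ ι-* n (+ (p ^ j)) ⟨
  ι (n * + (p ^ j))                            ∎)
  where
  j = K ∸ k

PowerEquiv : ℕ → ℕ → BQF ℤ → BQF ℤ → Set
PowerEquiv p e q g = Σ (Mat ℤ) λ N → detℤ N ≡ + (p ^ e) × actℤ N q ≡ scale (+ (p ^ e)) g

SL2Z[1/p]-equiv⇒PowerEquiv : ∀ {p q g} → SL2Z[1/p]-equiv p q g → ∃ λ e → PowerEquiv p e q g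
SL2Z[1/p]-equiv⇒PowerEquiv {p} {q} {g} (M , act-M) = K ℕ.+ K , N , det-N , act-N
  where
  m = mtxp M
  kα = proj₁ (αInt M)
  kβ = proj₁ (βInt M)
  kγ = proj₁ (γInt M)
  kδ = proj₁ (δInt M)
  K = kα ℕ.+ kβ ℕ.+ kγ ℕ.+ kδ
  s = ι (+ (p ^ K))

  ≤K : ∀ {k} → k ≤ kα ℕ.+ kβ ℕ.+ kγ → k ≤ K
  ≤K k≤ = ℕ.≤-trans k≤ (ℕ.m≤m+n _ kδ)

  nα = InZ[1/p]-raise p (α m) (αInt M) (≤K (ℕ.≤-trans (ℕ.m≤m+n kα kβ) (ℕ.m≤m+n _ kγ)))
  nβ = InZ[1/p]-raise p (β m) (βInt M) (≤K (ℕ.≤-trans (ℕ.m≤n+m kβ kα) (ℕ.m≤m+n _ kγ)))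
  nγ = InZ[1/p]-raise p (γ m) (γInt M) (≤K (ℕ.m≤n+m kγ (kα ℕ.+ kβ)))
  nδ = InZ[1/p]-raise p (δ m) (δInt M) (ℕ.m≤n+m kδ (kα ℕ.+ kβ ℕ.+ kγ))

  N : Mat ℤ
  N = mat (proj₁ nα) (proj₁ nβ) (proj₁ nγ) (proj₁ nδ)

  ιN≡s•m : ιM N ≡ s •ₘ m
  ιN≡s•m = mat-cong (sym (proj₂ nα)) (sym (proj₂ nβ)) (sym (proj₂ nγ)) (sym (proj₂ nδ))

  det-N : detℤ N ≡ + (p ^ (K ℕ.+ K))
  det-N = ι-injective (begin
    ι (detℤ N)                 ≡⟨ ι-detℤ N ⟩
    detℚ (ιM N)                ≡⟨ cong detℚ ιN≡s•m ⟩
    detℚ (s •ₘ m)              ≡⟨ detℚ-•ₘ s m ⟩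
    (s ℚ.* s) ℚ.* detℚ m       ≡⟨ cong ((s ℚ.* s) ℚ.*_) (detp≡1 M) ⟩
    (s ℚ.* s) ℚ.* ℚ.1ℚ         ≡⟨ ℚ-*-identityʳ (s ℚ.* s) ⟩
    s ℚ.* s                    ≡⟨ ι-pow-+ p K K ⟨
    ι (+ (p ^ (K ℕ.+ K)))      ∎)

  act-N : actℤ N q ≡ scale (+ (p ^ (K ℕ.+ K))) g
  act-N = ιF-injective (begin
    ιF (actℤ N q)                             ≡⟨ ι-actℤ N q ⟩
    actℚ (ιM N) (ιF q)                        ≡⟨ cong (λ m′ → actℚ m′ (ιF q)) ιN≡s•m ⟩
    actℚ (s •ₘ m) (ιF q)                      ≡⟨ actℚ-•ₘ s m (ιF q) ⟩
    scaleℚ (s ℚ.* s) (actℚ m (ιF q))          ≡⟨ cong (scaleℚ (s ℚ.* s)) act-M ⟩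
    scaleℚ (s ℚ.* s) (ιF g)                   ≡⟨ cong (λ t → scaleℚ t (ιF g)) (ι-pow-+ p K K) ⟨
    scaleℚ (ι (+ (p ^ (K ℕ.+ K)))) (ιF g)     ≡⟨ ιF-scale (+ (p ^ (K ℕ.+ K))) g ⟨
    ιF (scale (+ (p ^ (K ℕ.+ K))) g)          ∎)

SL2ℤ-equiv⇒SL2Z[1/p]-equiv : ∀ {p q g} → SL2ℤ-equiv q g → SL2Z[1/p]-equiv p q g
SL2ℤ-equiv⇒SL2Z[1/p]-equiv {q = q} (S , act-S) = record
  { mtxp = ιM (mtx S)
  ; αInt = 0 , α (mtx S) , ℚ-*-identityʳ _
  ; βInt = 0 , β (mtx S) , ℚ-*-identityʳ _
  ; γInt = 0 , γ (mtx S) , ℚ-*-identityʳ _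
  ; δInt = 0 , δ (mtx S) , ℚ-*-identityʳ _
  ; detp≡1 = trans (sym (ι-detℤ (mtx S))) (cong ι (det≡1 S))
  } , trans (sym (ι-actℤ (mtx S) q)) (cong ιF act-S)

-- Forms of discriminant 1 − 4p

1≢4* : ∀ k → + 1 ≢ + 4 * k
1≢4* k eq = 1≢4*ℕ ∣ k ∣ (trans (cong ∣_∣ eq) (ℤ.abs-* (+ 4) k))
  where
  1≢4*ℕ : ∀ m → 1 ≢ 4 ℕ.* m
  1≢4*ℕ zero ()
  1≢4*ℕ (suc zero) ()
  1≢4*ℕ (suc (suc m)) ()

disc≡1-4p⇒b-odd : ∀ {p A B C} →
  disc (form A B C) ≡ + 1 - + 4 * + p → ∃ λ h → B ≡ + 1 + h * + 2
disc≡1-4p⇒b-odd {p} {A} {B} {C} disc≡ with B %ℕ 2 | n%ℕd<d B 2 | a≡a%ℕn+[a/ℕn]*n B 2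
... | 0           | _                   | B≡2t   = ⊥-elim (1≢4* (t * t - A * C + + p) (begin
  + 1                                                              ≡⟨ identity₁ (+ p) ⟩
  + 1 - + 4 * + p + + 4 * + p                                      ≡⟨ cong (_+ + 4 * + p) disc≡ ⟨
  B * B - + 4 * (A * C) + + 4 * + p                                ≡⟨ cong (λ x → x * x - + 4 * (A * C) + + 4 * + p) B≡2t ⟩
  (+ 0 + t * + 2) * (+ 0 + t * + 2) - + 4 * (A * C) + + 4 * + p    ≡⟨ identity₂ t A C (+ p) ⟩
  + 4 * (t * t - A * C + + p)                                      ∎))
  where
  t = B /ℕ 2
  identity₁ : ∀ p → + 1 ≡ + 1 - + 4 * p + + 4 * p
  identity₁ = solve-∀
  identity₂ : ∀ t A C p →
    (+ 0 + t * + 2) * (+ 0 + t * + 2) - + 4 * (A * C) + + 4 * p ≡ + 4 * (t * t - A * C + p)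
  identity₂ = solve-∀
... | 1           | _                   | B≡1+2h = B /ℕ 2 , B≡1+2h
... | suc (suc _) | ℕ.s≤s (ℕ.s≤s ()) | _

disc≡1-4p⇒norm : ∀ {p A h C} →
  disc (form A (+ 1 + h * + 2) C) ≡ + 1 - + 4 * + p → A * C - h * h - h ≡ + p
disc≡1-4p⇒norm {p} {A} {h} {C} disc≡ = ℤ.*-cancelˡ-≡ (+ 4) _ _ (begin
  + 4 * (A * C - h * h - h)              ≡⟨ identity₁ A h C ⟩
  + 1 - disc (form A (+ 1 + h * + 2) C)  ≡⟨ cong (_-_ (+ 1)) disc≡ ⟩
  + 1 - (+ 1 - + 4 * + p)                ≡⟨ identity₂ (+ p) ⟩
  + 4 * + p                              ∎)
  where
  identity₁ : ∀ A h C →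
    + 4 * (A * C - h * h - h) ≡ + 1 - ((+ 1 + h * + 2) * (+ 1 + h * + 2) - + 4 * (A * C))
  identity₁ = solve-∀
  identity₂ : ∀ p → + 1 - (+ 1 - + 4 * p) ≡ + 4 * p
  identity₂ = solve-∀

-- Dividing p out of an integer matrix

module Descent {p} (p-prime : Prime p) {A h C : ℤ} (norm : A * C - h * h - h ≡ + p) where

  instance
    p≢0 : ℕ.NonZero p
    p≢0 = prime⇒nonZero p-prime

  f : BQF ℤ
  f = form A (+ 1 + h * + 2) C

  W : Mat ℤ
  W = mat (- h) (- C) A (h + + 1)

  by-norm : ∀ {z} x → z ≡ (A * C - h * h - h) * x → z ≡ + p * x
  by-norm x eq = trans eq (cong (_* x) norm)

  det-W : detℤ W ≡ + p
  det-W = trans (identity A h C) norm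
    where
    identity : ∀ A h C → - h * (h + + 1) - - C * A ≡ A * C - h * h - h
    identity = solve-∀

  W·adj-W : ∀ v → W · (adj W · v) ≡ + p • v
  W·adj-W v = trans (·-adj W v) (cong (_• v) det-W)

  adj-W·W : ∀ v → adj W · (W · v) ≡ + p • v
  adj-W·W v = trans (adj-· W v) (cong (_• v) det-W)

  act-W : actℤ W f ≡ scale (+ p) f
  act-W = form-cong
    (by-norm A (first A h C)) (by-norm (+ 1 + h * + 2) (second A h C)) (by-norm C (third A h C))
    where
    first : ∀ A h C →
      A * (- h * - h) + (+ 1 + h * + 2) * (- h * A) + C * (A * A) ≡ (A * C - h * h - h) * A
    first = solve-∀
    second : ∀ A h C →
      + 2 * A * (- h * - C) + (+ 1 + h * + 2) * (- h * (h + + 1) + - C * A) + + 2 * C * (A * (h + + 1))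
        ≡ (A * C - h * h - h) * (+ 1 + h * + 2)
    second = solve-∀
    third : ∀ A h C →
      A * (- C * - C) + (+ 1 + h * + 2) * (- C * (h + + 1)) + C * ((h + + 1) * (h + + 1))
        ≡ (A * C - h * h - h) * C
    third = solve-∀

  act-adj-W : actℤ (adj W) f ≡ scale (+ p) f
  act-adj-W = form-cong
    (by-norm A (first A h C)) (by-norm (+ 1 + h * + 2) (second A h C)) (by-norm C (third A h C))
    where
    first : ∀ A h C →
      A * ((h + + 1) * (h + + 1)) + (+ 1 + h * + 2) * ((h + + 1) * - A) + C * (- A * - A)
        ≡ (A * C - h * h - h) * A
    first = solve-∀
    second : ∀ A h C →
      + 2 * A * ((h + + 1) * - - C) + (+ 1 + h * + 2) * ((h + + 1) * - h + - - C * - A) + + 2 * C * (- A * - h)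
        ≡ (A * C - h * h - h) * (+ 1 + h * + 2)
    second = solve-∀
    third : ∀ A h C →
      A * (- - C * - - C) + (+ 1 + h * + 2) * (- - C * - h) + C * (- h * - h) ≡ (A * C - h * h - h) * C
    third = solve-∀

  ∣-by-norm : ∀ {z} x k v → z ≡ (A * C - h * h - h) * x + k * value f v → + p ∣ value f v → + p ∣ z
  ∣-by-norm x k v eq p∣fv = subst (+ p ∣_) (sym (trans eq (cong (λ n → n * x + k * value f v) norm)))
    (∣m∣n⇒∣m+n (∣m⇒∣m*n x ∣-refl) (∣n⇒∣m*n k p∣fv))

  split : ∀ v → + p ∣ value f v → KerMod (+ p) (adj W) v ⊎ KerMod (+ p) W v
  split (x , y) p∣fv = prime-∣ᵥ-⊎ p-prime
    (∣-by-norm (x * x) (- C)     (x , y) (w₁u₁ A h C x y) p∣fv)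
    (∣-by-norm (x * y) (h + + 1) (x , y) (w₂u₁ A h C x y) p∣fv)
    (∣-by-norm (x * y) h         (x , y) (w₁u₂ A h C x y) p∣fv)
    (∣-by-norm (y * y) (- A)     (x , y) (w₂u₂ A h C x y) p∣fv)
    where
    w₁u₁ : ∀ A h C x y → (- h * x + - C * y) * ((h + + 1) * x + - - C * y)
      ≡ (A * C - h * h - h) * (x * x) + - C * (A * (x * x) + (+ 1 + h * + 2) * (x * y) + C * (y * y))
    w₁u₁ = solve-∀
    w₂u₁ : ∀ A h C x y → (A * x + (h + + 1) * y) * ((h + + 1) * x + - - C * y)
      ≡ (A * C - h * h - h) * (x * y) + (h + + 1) * (A * (x * x) + (+ 1 + h * + 2) * (x * y) + C * (y * y))
    w₂u₁ = solve-∀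
    w₁u₂ : ∀ A h C x y → (- h * x + - C * y) * (- A * x + - h * y)
      ≡ (A * C - h * h - h) * (x * y) + h * (A * (x * x) + (+ 1 + h * + 2) * (x * y) + C * (y * y))
    w₁u₂ = solve-∀
    w₂u₂ : ∀ A h C x y → (A * x + (h + + 1) * y) * (- A * x + - h * y)
      ≡ (A * C - h * h - h) * (y * y) + - A * (A * (x * x) + (+ 1 + h * + 2) * (x * y) + C * (y * y))
    w₂u₂ = solve-∀

  p^[1+e] : ∀ e → + (p ^ suc e) ≡ + p * + (p ^ e)
  p^[1+e] e = ℤ.pos-* p (p ^ e)

  p∣p^[1+e]* : ∀ e x → + p ∣ + (p ^ suc e) * x
  p∣p^[1+e]* e x = ∣m⇒∣m*n x (∣ᵤ⇒∣ {+ p} {+ (p ^ suc e)} (ℕ.m∣m*n (p ^ e)))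

  factor-out : ∀ {e g} X Y → (∀ v → X · (Y · v) ≡ + p • v) →
    detℤ X ≡ + p → actℤ X f ≡ scale (+ p) f →
    ∀ N → KerMod (+ p) Y (col₁ N) → KerMod (+ p) Y (col₂ N) →
    detℤ N ≡ + (p ^ suc e) → actℤ N f ≡ scale (+ (p ^ suc e)) g → PowerEquiv p e f g
  factor-out {e} {g} X Y XY≡p det-X act-X N ker₁ ker₂ det-N act-N
    with KerMod⇒image {X = X} {Y} {col₁ N} XY≡p ker₁ | KerMod⇒image {X = X} {Y} {col₂ N} XY≡p ker₂
  ... | q , Xq≡n₁ | r , Xr≡n₂ = fromCols q r ,
    cancel-factor {X = X} {fromCols q r} {N} det-X act-X (cong₂ fromCols Xq≡n₁ Xr≡n₂)
      (trans det-N (p^[1+e] e)) (trans act-N (cong (λ k → scale k g) (p^[1+e] e)))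

  descent-step : ∀ e g → PowerEquiv p (suc e) f g → PowerEquiv p e f g
  descent-step e g (N , det-N , act-N) =
    peel (same-KerMod {+ p} {adj W} {W} {n₁} {n₂}
      (split n₁ p∣f[n₁]) (split n₂ p∣f[n₂]) (split (n₁ +ᵥ n₂) p∣f[n₁+n₂]))
    where
    n₁ n₂ : ℤ²
    n₁ = col₁ N
    n₂ = col₂ N

    p∣f[n₁] : + p ∣ value f n₁
    p∣f[n₁] = subst (+ p ∣_) (sym (cong a act-N)) (p∣p^[1+e]* e (a g))

    p∣f[n₂] : + p ∣ value f n₂
    p∣f[n₂] = subst (+ p ∣_) (sym (cong c act-N)) (p∣p^[1+e]* e (c g))

    p∣polar : + p ∣ polar f n₁ n₂
    p∣polar = subst (+ p ∣_) (sym (cong b act-N)) (p∣p^[1+e]* e (b g))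

    p∣f[n₁+n₂] : + p ∣ value f (n₁ +ᵥ n₂)
    p∣f[n₁+n₂] = subst (+ p ∣_) (sym (value-+ᵥ f n₁ n₂))
      (∣m∣n⇒∣m+n (∣m∣n⇒∣m+n p∣f[n₁] p∣polar) p∣f[n₂])

    peel : KerMod (+ p) (adj W) n₁ × KerMod (+ p) (adj W) n₂ ⊎ KerMod (+ p) W n₁ × KerMod (+ p) W n₂ →
           PowerEquiv p e f g
    peel (inj₁ (ker₁ , ker₂)) =
      factor-out {e} {g} W (adj W) W·adj-W det-W act-W N ker₁ ker₂ det-N act-N
    peel (inj₂ (ker₁ , ker₂)) =
      factor-out {e} {g} (adj W) W adj-W·W (trans (detℤ-adj W) det-W) act-adj-W N ker₁ ker₂ det-N act-N

  descent : ∀ e g → PowerEquiv p e f g → SL2ℤ-equiv f g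
  descent zero    g (N , det-N , act-N) = record { mtx = N ; det≡1 = det-N } , trans act-N (scale-1 g)
  descent (suc e) g equiv               = descent e g (descent-step e g equiv)

corollary2p9 : (p : ℕ) → Prime p → (f g : BQF ℤ) →
    disc f ≡ + 1 - + 4 * + p → disc g ≡ + 1 - + 4 * + p →
    SL2Z[1/p]-equiv p f g ⇔ SL2ℤ-equiv f g
corollary2p9 p p-prime (form A B C) g disc-f _ with disc≡1-4p⇒b-odd {p} {A} {B} {C} disc-f
... | h , refl = mk⇔
  (λ equiv → let e , N = SL2Z[1/p]-equiv⇒PowerEquiv {p} {f} {g} equiv in descent e g N)
  (SL2ℤ-equiv⇒SL2Z[1/p]-equiv {p} {f} {g})
  where open Descent p-prime {A} {h} {C} (disc≡1-4p⇒norm {p} {A} {h} {C} disc-f)
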